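{- Let $n \geq 1$ and $k \geq 2$ be integers, let $T_{n,k}$ be the dendrimer, and let $\ell$ be an even integer with $2 \leq \ell \leq 2n$. Then the number $n^{2}_{\ell}(T_{n,k})$ of paths of length $\ell$ in $T_{n,k}$ both of whose end vertices are leaves of $T_{n,k}$ is $$n^{2}_{\ell}(T_{n, k}) = \begin{cases} k(k - 1)^{n+\frac{\ell}{2}- 3}\binom{k - 1}{2} & \text{if } 2 \leq \ell \leq 2n-2,\\[6pt] (k - 1)^{\ell - 2}\binom{k}{2} & \text{if } \ell = 2n.\end{cases}$$
   Context: For integers $n \geq 1$ and $k \geq 2$, the dendrimer $T_{n,k}$ is the rooted tree with a root $r$ such that every vertex at distance less than $n$ from $r$ has degree exactly $k$ and every vertex at distance exactly $n$ from $r$ is a leaf. A path of length $\ell$ is a path with $\ell$ edges, counted as a subgraph (a path and its reversal are the same path). A leaf is a vertex of degree $1$. -}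

module Defs where

open import Data.Nat using (ℕ; zero; suc; _+_; _*_; _∸_; _^_; _≤_; _<_)
open import Data.Nat.Combinatorics using (_C_)
open import Data.List using (List; []; _∷_; length)
open import Data.Fin using (Fin; inject₁; fromℕ) renaming (zero to fzero; suc to fsuc)
open import Data.Vec using (Vec; lookup)
open import Data.Product using (Σ; ∃; _×_; _,_)
open import Data.Sum using (_⊎_)
open import Function.Definitions using (Injective)
open import Relation.Binary.PropositionalEquality using (_≡_)

-- Vertices of the dendrimer T_{n,k}.
-- root : the root r (depth 0).
-- node i xs p : the vertex reached from the root by first going to the
--   i-th child of the root (i : Fin k), then successively to children
--   indexed by Fin (k ∸ 1) (each non-root internal vertex has k-1 children).
--   The list xs stores these later steps in REVERSE order (head = last step).
--   The depth is 1 + length xs, and p : length xs < n says depth ≤ n.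
data Vertex (n k : ℕ) : Set where
  root : Vertex n k
  node : (i : Fin k) (xs : List (Fin (k ∸ 1))) → length xs < n → Vertex n k

data ChildOf {n k : ℕ} : Vertex n k → Vertex n k → Set where
  child-root : (i : Fin k) (p : 0 < n) → ChildOf root (node i [] p)
  child-node : (i : Fin k) (x : Fin (k ∸ 1)) (xs : List (Fin (k ∸ 1)))
               (p : length xs < n) (q : length (x ∷ xs) < n) →
               ChildOf (node i xs p) (node i (x ∷ xs) q)

Adj : {n k : ℕ} → Vertex n k → Vertex n k → Set
Adj u v = ChildOf u v ⊎ ChildOf v u

Leaf : {n k : ℕ} → Vertex n k → Set
Leaf {n} {k} v = Σ (Vertex n k) λ u → Adj v u × ((w : Vertex n k) → Adj v w → w ≡ u)

IsPath : {n k : ℕ} (ℓ : ℕ) → Vec (Vertex n k) (suc ℓ) → Set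
IsPath ℓ w = Injective _≡_ _≡_ (lookup w) × ((i : Fin ℓ) → Adj (lookup w (inject₁ i)) (lookup w (fsuc i)))

IsLeafPath : {n k : ℕ} (ℓ : ℕ) → Vec (Vertex n k) (suc ℓ) → Set
IsLeafPath ℓ w = IsPath ℓ w × Leaf (lookup w fzero) × Leaf (lookup w (fromℕ ℓ))

HasCount : {A : Set} → (A → Set) → ℕ → Set
HasCount {A} P N = Σ (Fin N → A) λ e →
  Injective _≡_ _≡_ e × ((i : Fin N) → P (e i)) × ((a : A) → P a → ∃ λ i → e i ≡ a)

-- Number of paths of length ℓ (undirected, i.e. path and reversal identified)
-- with both ends leaves equals N, i.e. the directed such paths number 2 * N
-- (for ℓ ≥ 1 a path and its reversal are distinct vertex sequences).
LeafPathCount : (n k ℓ N : ℕ) → Set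
LeafPathCount n k ℓ N = HasCount (IsLeafPath {n} {k} ℓ) (2 * N)

module Submission where

-- A leaf path of length ℓ = 2h climbs h steps and then descends h steps. Once a path steps
-- down to a child it can never step up again, since that would revisit the child's parent;
-- so it is a climb followed by a descent, and as it starts and ends at depth n and no vertex is
-- deeper than n, both parts have length h. Hence a leaf path is determined by its ordered pair
-- of end leaves (u, v), and the pairs that occur are exactly those whose lowest common ancestor
-- has depth d = n − h. If d = 0 such a pair is two distinct children of the root followed by
-- arbitrary descents of length n − 1, giving k(k − 1)·(k − 1)^(2n−2) pairs. If d ≥ 1 it is a
-- common ancestor at depth d (k(k − 1)^(d−1) choices), two distinct children of it
-- ((k − 1)(k − 2) choices) and descents of length h − 1 below them, giving
-- k(k − 1)^(d−1)·(k − 1)(k − 2)·(k − 1)^(2h−2). Every undirected path is counted twice.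

open import Defs
open import Data.Nat using (ℕ; zero; suc; _+_; _*_; _∸_; _^_; _≤_; _<_; z≤n; s≤s; s≤s⁻¹; _≟_; _≤?_; _<?_)
open import Data.Nat.Properties
open import Data.Nat.DivMod using (_/_; m*n/n≡m)
open import Data.Nat.Divisibility using (_∣_; divides)
open import Data.Nat.Combinatorics using (_C_; nC1≡n; nCk+nC[k+1]≡[n+1]C[k+1])
open import Data.Nat.Tactic.RingSolver using (solve-∀)
open import Data.List using (List; []; _∷_; length; drop; _++_)
open import Data.List.Properties
  using (length-drop; drop-drop; drop-all; length-++; length-++-≤ʳ; ∷-injective; ++-assoc; ++-identityʳ)
open import Data.Fin using (Fin; toℕ; fromℕ; fromℕ<; inject₁; punchIn; punchOut)
  renaming (zero to fzero; suc to fsuc)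
open import Data.Fin.Properties
  using (*↔×; punchIn-injective; punchInᵢ≢i; punchIn-punchOut; toℕ-injective; toℕ<n; toℕ≤pred[n];
         toℕ-fromℕ; toℕ-fromℕ<; fromℕ<-toℕ; toℕ-inject₁)
open import Data.Vec using (Vec; []; _∷_; lookup; tabulate; toList; fromList)
import Data.Vec.Properties as Vec
open import Data.Vec.Properties
  using (lookup∘tabulate; tabulate∘lookup; tabulate-cong; toList∘fromList; length-toList;
         toList-injective; cast-is-id)
open import Data.Product using (∃; _×_; _,_; proj₁; proj₂; uncurry)
import Data.Product as Product
open import Data.Sum using (inj₁; inj₂; swap)
open import Data.Empty using (⊥-elim)
open import Function using (_∘_; id)
open import Function.Bundles using (Inverse; _⇔_; mk⇔; Equivalence)
open import Relation.Nullary using (¬_; yes; no)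
open import Relation.Unary using (U; _⟨×⟩_)
open import Relation.Binary.PropositionalEquality
  using (_≡_; _≢_; refl; sym; trans; cong; cong₂; subst; subst₂; module ≡-Reasoning)

HasCount-map : {A B : Set} {P : A → Set} {Q : B → Set} {M : ℕ} (f : A → B) →
  (∀ {a a′} → P a → P a′ → f a ≡ f a′ → a ≡ a′) →
  (∀ a → P a → Q (f a)) →
  (∀ b → Q b → ∃ λ a → P a × f a ≡ b) →
  HasCount P M → HasCount Q M
HasCount-map {Q = Q} f f-inj f-Q f-onto (e , e-inj , e-P , e-onto) =
  f ∘ e , e-inj ∘ f-inj (e-P _) (e-P _) , (λ i → f-Q (e i) (e-P i)) , onto
  where
  onto : ∀ b → Q b → ∃ λ i → f (e i) ≡ b
  onto b q with f-onto b q
  ... | a , p , refl with e-onto a p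
  ... | i , refl = i , refl

HasCount-× : {A B : Set} {P : A → Set} {Q : B → Set} {M N : ℕ} →
  HasCount P M → HasCount Q N → HasCount (P ⟨×⟩ Q) (M * N)
HasCount-× {P = P} {Q} {M} {N} (e , e-inj , e-P , e-onto) (e′ , e′-inj , e′-P , e′-onto) =
  Product.map e e′ ∘ to , inj , (λ x → e-P _ , e′-P _) , onto
  where
  open Inverse (*↔× {M} {N}) using (to; from; strictlyInverseˡ; strictlyInverseʳ)
  inj : ∀ {x y} → Product.map e e′ (to x) ≡ Product.map e e′ (to y) → x ≡ y
  inj {x} {y} eq = begin
    x              ≡⟨ strictlyInverseʳ x ⟨
    from (to x)    ≡⟨ cong from (cong₂ _,_ (e-inj (cong proj₁ eq)) (e′-inj (cong proj₂ eq))) ⟩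
    from (to y)    ≡⟨ strictlyInverseʳ y ⟩
    y              ∎
    where open ≡-Reasoning
  onto : ∀ x → (P ⟨×⟩ Q) x → ∃ λ i → Product.map e e′ (to i) ≡ x
  onto (a , b) (p , q) with e-onto a p | e′-onto b q
  ... | i , refl | j , refl = from (i , j) , cong (Product.map e e′) (strictlyInverseˡ (i , j))

HasCount-Fin : ∀ M → HasCount {Fin M} U M
HasCount-Fin M = id , id , _ , λ i _ → i , refl

HasCount-Vec : {A : Set} {a : ℕ} → HasCount {A} U a → ∀ t → HasCount {Vec A t} U (a ^ t)
HasCount-Vec c zero = (λ _ → []) , (λ { {fzero} {fzero} _ → refl }) , _ , λ { [] _ → fzero , refl }
HasCount-Vec c (suc t) =
  HasCount-map (uncurry _∷_) (λ _ _ eq → cong₂ _,_ (Vec.∷-injectiveˡ eq) (Vec.∷-injectiveʳ eq)) _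
    (λ { (x ∷ xs) _ → (x , xs) , _ , refl }) (HasCount-× c (HasCount-Vec c t))

HasCount-≢ : ∀ m → HasCount {Fin (suc m) × Fin (suc m)} (uncurry _≢_) (suc m * m)
HasCount-≢ m = HasCount-map punch inj (λ (a , b) _ → punchInᵢ≢i a b ∘ sym) onto
  (HasCount-× (HasCount-Fin (suc m)) (HasCount-Fin m))
  where
  punch : Fin (suc m) × Fin m → Fin (suc m) × Fin (suc m)
  punch (a , b) = a , punchIn a b
  inj : ∀ {x y} → (U ⟨×⟩ U) x → (U ⟨×⟩ U) y → punch x ≡ punch y → x ≡ y
  inj {a , b} {a′ , b′} _ _ eq with refl ← cong proj₁ eq =
    cong (a ,_) (punchIn-injective a b b′ (cong proj₂ eq))
  onto : ∀ x → uncurry _≢_ x → ∃ λ y → (U ⟨×⟩ U) y × punch y ≡ x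
  onto (a , c) a≢c = (a , punchOut a≢c) , _ , cong (a ,_) (punchIn-punchOut a≢c)

drop-length-++ : ∀ {A : Set} (xs ys : List A) → drop (length xs) (xs ++ ys) ≡ ys
drop-length-++ [] ys = refl
drop-length-++ (x ∷ xs) ys = drop-length-++ xs ys

++-cancel-equal-length : ∀ {A : Set} (xs ys : List A) {xs′ ys′} →
  length xs ≡ length ys → xs ++ xs′ ≡ ys ++ ys′ → xs ≡ ys × xs′ ≡ ys′
++-cancel-equal-length [] [] _ eq = refl , eq
++-cancel-equal-length (x ∷ xs) (y ∷ ys) len eq with refl , eq′ ← ∷-injective eq =
  Product.map₁ (cong (x ∷_)) (++-cancel-equal-length xs ys (suc-injective len) eq′)

split-at : ∀ {A : Set} s {t} (xs : List A) → length xs ≡ s + suc t →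
  ∃ λ pre → ∃ λ c → ∃ λ post → length pre ≡ s × length post ≡ t × xs ≡ pre ++ c ∷ post
split-at zero (x ∷ xs) len = [] , x , xs , refl , suc-injective len , refl
split-at (suc s) (x ∷ xs) len with pre , c , post , refl , len′ , refl ← split-at s xs (suc-injective len) =
  x ∷ pre , c , post , refl , len′ , refl

toList-injective-≡ : ∀ {A : Set} {t} {xs ys : Vec A t} → toList xs ≡ toList ys → xs ≡ ys
toList-injective-≡ {xs = xs} {ys} eq = trans (sym (cast-is-id refl xs)) (toList-injective refl xs ys eq)

toList-preimage : ∀ {A : Set} (xs : List A) {t} → length xs ≡ t → ∃ λ (w : Vec A t) → toList w ≡ xs
toList-preimage xs refl = fromList xs , toList∘fromList xs

at : ∀ {A : Set} {ℓ} → Vec A (suc ℓ) → ℕ → A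
at {ℓ = ℓ} w j with j <? suc ℓ
... | yes j<1+ℓ = lookup w (fromℕ< j<1+ℓ)
... | no _ = lookup w fzero

at-lookup : ∀ {A : Set} {ℓ} (w : Vec A (suc ℓ)) (i : Fin (suc ℓ)) {j} → toℕ i ≡ j → at w j ≡ lookup w i
at-lookup {ℓ = ℓ} w i refl with toℕ i <? suc ℓ
... | yes i<1+ℓ = cong (lookup w) (fromℕ<-toℕ i i<1+ℓ)
... | no i≮1+ℓ = ⊥-elim (i≮1+ℓ (toℕ<n i))

-- The dendrimer T_{n,m+2}: taking k = m + 2 makes the step type Fin (k ∸ 1) of Defs
-- definitionally Fin (suc m).
module Dendrimer (n m : ℕ) where

  V : Set
  V = Vertex n (suc (suc m))

  FirstStep : Set
  FirstStep = Fin (suc (suc m))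
  Step : Set
  Step = Fin (suc m)

  depth : V → ℕ
  depth root = 0
  depth (node _ xs _) = suc (length xs)

  depth≤n : ∀ v → depth v ≤ n
  depth≤n root = z≤n
  depth≤n (node _ _ p) = p

  node-cong : ∀ {i j : FirstStep} {xs ys : List Step} {p : length xs < n} {q : length ys < n} →
    i ≡ j → xs ≡ ys → node i xs p ≡ node j ys q
  node-cong {p = p} {q} refl refl = cong (node _ _) (<-irrelevant p q)

  node-injective : ∀ {i j : FirstStep} {xs ys : List Step} {p : length xs < n} {q : length ys < n} →
    node i xs p ≡ node j ys q → i ≡ j × xs ≡ ys
  node-injective refl = refl , refl

  drop-length< : ∀ {A : Set} t (xs : List A) → length xs < n → length (drop t xs) < n
  drop-length< t xs p = subst (_< n) (sym (length-drop t xs)) (≤-<-trans (m∸n≤m _ t) p)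

  -- For t ≥ depth v this is v itself.
  ancestor : V → ℕ → V
  ancestor root _ = root
  ancestor (node i xs p) zero = root
  ancestor (node i xs p) (suc t) = node i (drop (length xs ∸ t) xs) (drop-length< (length xs ∸ t) xs p)

  depth-ancestor : ∀ v {t} → t ≤ depth v → depth (ancestor v t) ≡ t
  depth-ancestor root z≤n = refl
  depth-ancestor (node i xs p) {zero} _ = refl
  depth-ancestor (node i xs p) {suc t} (s≤s t≤L) =
    cong suc (trans (length-drop (length xs ∸ t) xs) (m∸[m∸n]≡n t≤L))

  ancestor-depth : ∀ v → ancestor v (depth v) ≡ v
  ancestor-depth root = refl
  ancestor-depth (node i xs p) = node-cong refl (cong (λ t → drop t xs) (n∸n≡0 (length xs)))

  ancestor-ancestor : ∀ v {s t} → s ≤ t → t ≤ depth v → ancestor (ancestor v t) s ≡ ancestor v s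
  ancestor-ancestor root _ _ = refl
  ancestor-ancestor (node i xs p) {zero} {zero} _ _ = refl
  ancestor-ancestor (node i xs p) {zero} {suc t} _ _ = refl
  ancestor-ancestor (node i xs p) {suc s} {suc t} (s≤s s≤t) (s≤s t≤L) = node-cong refl (begin
    drop (length (drop (L ∸ t) xs) ∸ s) (drop (L ∸ t) xs)
      ≡⟨ cong (λ r → drop (r ∸ s) (drop (L ∸ t) xs)) (suc-injective (depth-ancestor (node i xs p) (s≤s t≤L))) ⟩
    drop (t ∸ s) (drop (L ∸ t) xs)   ≡⟨ drop-drop (L ∸ t) (t ∸ s) xs ⟩
    drop ((L ∸ t) + (t ∸ s)) xs      ≡⟨ cong (λ r → drop r xs) (+-∸-assoc (L ∸ t) s≤t) ⟨
    drop ((L ∸ t + t) ∸ s) xs        ≡⟨ cong (λ r → drop (r ∸ s) xs) (m∸n+n≡m t≤L) ⟩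
    drop (L ∸ s) xs                  ∎)
    where
    open ≡-Reasoning
    L : ℕ
    L = length xs

  child-depth : ∀ {a b} → ChildOf a b → depth b ≡ suc (depth a)
  child-depth (child-root i p) = refl
  child-depth (child-node i x xs p q) = refl

  ancestor≡parent : ∀ {a b} → ChildOf a b → ancestor b (depth a) ≡ a
  ancestor≡parent (child-root i p) = refl
  ancestor≡parent (child-node i x xs p q) =
    node-cong refl (cong (λ t → drop t (x ∷ xs)) (m+n∸n≡m 1 (length xs)))

  parent-unique : ∀ {a b c} → ChildOf a b → ChildOf c b → a ≡ c
  parent-unique {a} {b} {c} ab cb = begin
    a                     ≡⟨ ancestor≡parent ab ⟨
    ancestor b (depth a)  ≡⟨ cong (ancestor b) (suc-injective (trans (sym (child-depth ab)) (child-depth cb))) ⟩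
    ancestor b (depth c)  ≡⟨ ancestor≡parent cb ⟩
    c                     ∎
    where open ≡-Reasoning

  child-drop : ∀ (i : FirstStep) (xs : List Step) t {p q} → t < length xs →
    ChildOf {n} (node i (drop (suc t) xs) p) (node i (drop t xs) q)
  child-drop i (x ∷ xs) zero _ = child-node i x xs _ _
  child-drop i (x ∷ xs) (suc t) (s≤s t<L) = child-drop i xs t t<L

  ancestor-child : ∀ v {t} → t < depth v → ChildOf (ancestor v t) (ancestor v (suc t))
  ancestor-child (node i xs p) {zero} _ = child-root-[] (drop-all (length xs) xs ≤-refl)
    where
    child-root-[] : ∀ {ys q} → ys ≡ [] → ChildOf root (node i ys q)
    child-root-[] refl = child-root i _
  ancestor-child v@(node i xs p) {suc t} (s≤s t<L) =
    subst (λ a → ChildOf a (ancestor v (suc (suc t))))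
      (node-cong refl (cong (λ r → drop r xs) (sym (+-∸-assoc 1 t<L))))
      (child-drop i xs (length xs ∸ suc t) {p = drop-length< (suc (length xs ∸ suc t)) xs p}
        (∸-monoʳ-< {o = 0} (s≤s z≤n) t<L))

  ChildOf-ancestor : ∀ v {t} → depth v ≡ suc t → ChildOf (ancestor v t) v
  ChildOf-ancestor v {t} d≡ = subst (ChildOf _) (trans (cong (ancestor v) (sym d≡)) (ancestor-depth v))
    (ancestor-child v (≤-reflexive (sym d≡)))

  ancestor-injective : ∀ u {s t} → s ≤ depth u → t ≤ depth u → ancestor u s ≡ ancestor u t → s ≡ t
  ancestor-injective u s≤ t≤ eq =
    trans (sym (depth-ancestor u s≤)) (trans (cong depth eq) (depth-ancestor u t≤))

  depth≡n⇒Leaf : 0 < n → ∀ v → depth v ≡ n → Leaf v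
  depth≡n⇒Leaf 0<n root 0≡n = ⊥-elim (<⇒≢ 0<n 0≡n)
  depth≡n⇒Leaf _ v@(node i xs p) d≡n = ancestor v (length xs) , inj₂ (ChildOf-ancestor v refl) , unique
    where
    unique : ∀ w → Adj v w → w ≡ ancestor v (length xs)
    unique w (inj₁ v⋖w) =
      ⊥-elim (<⇒≱ (≤-reflexive (cong suc (sym d≡n))) (subst (_≤ n) (child-depth v⋖w) (depth≤n w)))
    unique w (inj₂ w⋖v) =
      trans (sym (ancestor≡parent w⋖v)) (cong (ancestor v) (suc-injective (sym (child-depth w⋖v))))

  Leaf⇒depth≡n : 0 < n → ∀ v → Leaf v → depth v ≡ n
  Leaf⇒depth≡n 0<n root (u , _ , unique)
    with () ← proj₁ (node-injective (trans (unique _ (inj₁ (child-root fzero 0<n)))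
                                           (sym (unique _ (inj₁ (child-root (fsuc fzero) 0<n))))))
  Leaf⇒depth≡n 0<n v@(node i xs p) (u , _ , unique) with suc (length xs) ≟ n
  ... | yes d≡n = d≡n
  ... | no d≢n = ⊥-elim (<⇒≢ (<-trans (n<1+n _) (n<1+n _))
                  (sym (trans (cong depth child≡parent) (depth-ancestor v (n≤1+n _)))))
    where
    child : ChildOf v (node i (fzero ∷ xs) (≤∧≢⇒< p d≢n))
    child = child-node i fzero xs p _
    child≡parent : node i (fzero ∷ xs) (≤∧≢⇒< p d≢n) ≡ ancestor v (length xs)
    child≡parent = trans (unique _ (inj₁ child)) (sym (unique _ (inj₂ (ChildOf-ancestor v refl))))

  -- Shape of leaf paths

  IsPathFn : ℕ → (ℕ → V) → Set
  IsPathFn ℓ F =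
    (∀ {i j} → i ≤ ℓ → j ≤ ℓ → F i ≡ F j → i ≡ j) × (∀ {j} → j < ℓ → Adj (F j) (F (suc j)))

  IsPath⇒IsPathFn : ∀ {ℓ} {w : Vec V (suc ℓ)} → IsPath ℓ w → IsPathFn ℓ (at w)
  IsPath⇒IsPathFn {ℓ} {w} (w-inj , w-adj) = inj , adj
    where
    at-fromℕ< : ∀ {j} (j<1+ℓ : j < suc ℓ) → at w j ≡ lookup w (fromℕ< j<1+ℓ)
    at-fromℕ< j<1+ℓ = at-lookup w _ (toℕ-fromℕ< j<1+ℓ)
    inj : ∀ {i j} → i ≤ ℓ → j ≤ ℓ → at w i ≡ at w j → i ≡ j
    inj i≤ℓ j≤ℓ eq = trans (sym (toℕ-fromℕ< (s≤s i≤ℓ))) (trans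
      (cong toℕ (w-inj (trans (sym (at-fromℕ< (s≤s i≤ℓ))) (trans eq (at-fromℕ< (s≤s j≤ℓ))))))
      (toℕ-fromℕ< (s≤s j≤ℓ)))
    adj : ∀ {j} → j < ℓ → Adj (at w j) (at w (suc j))
    adj j<ℓ = subst₂ Adj
      (sym (at-lookup w (inject₁ i) (trans (toℕ-inject₁ i) (toℕ-fromℕ< j<ℓ))))
      (sym (at-lookup w (fsuc i) (cong suc (toℕ-fromℕ< j<ℓ))))
      (w-adj i)
      where
      i : Fin ℓ
      i = fromℕ< j<ℓ

  reverse-IsPathFn : ∀ {ℓ F} → IsPathFn ℓ F → IsPathFn ℓ (λ j → F (ℓ ∸ j))
  reverse-IsPathFn {ℓ} {F} (F-inj , F-adj) = inj , adj
    where
    inj : ∀ {i j} → i ≤ ℓ → j ≤ ℓ → F (ℓ ∸ i) ≡ F (ℓ ∸ j) → i ≡ j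
    inj {i} {j} i≤ℓ j≤ℓ eq = ∸-cancelˡ-≡ i≤ℓ j≤ℓ (F-inj (m∸n≤m ℓ i) (m∸n≤m ℓ j) eq)
    adj : ∀ {j} → j < ℓ → Adj (F (ℓ ∸ j)) (F (ℓ ∸ suc j))
    adj {j} j<ℓ = subst (λ i → Adj (F i) (F (ℓ ∸ suc j))) (sym (+-∸-assoc 1 j<ℓ))
                    (swap (F-adj (∸-monoʳ-< {o = 0} (s≤s z≤n) j<ℓ)))

  -- A path never steps down and then up again (it would revisit the unique parent). So if, after
  -- climbing j < h steps from depth n, it stepped down, it would descend for the remaining
  -- ℓ ∸ j > j steps and end deeper than n.
  module Climb {ℓ h : ℕ} (ℓ≡h+h : ℓ ≡ h + h) {F : ℕ → V} (path : IsPathFn ℓ F)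
               (start : depth (F 0) ≡ n) where

    private
      F-inj : ∀ {i j} → i ≤ ℓ → j ≤ ℓ → F i ≡ F j → i ≡ j
      F-inj = proj₁ path
      F-adj : ∀ {j} → j < ℓ → Adj (F j) (F (suc j))
      F-adj = proj₂ path
      h≤ℓ : h ≤ ℓ
      h≤ℓ = subst (h ≤_) (sym ℓ≡h+h) (m≤m+n h h)

    down-persists : ∀ {j} → suc j < ℓ →
      ChildOf (F j) (F (suc j)) → ChildOf (F (suc j)) (F (suc (suc j)))
    down-persists {j} lt down with F-adj lt
    ... | inj₁ down′ = down′
    ... | inj₂ up = ⊥-elim (<⇒≢ (<-trans (n<1+n j) (n<1+n (suc j)))
                      (sym (F-inj lt (<⇒≤ (<-trans (n<1+n j) lt)) (parent-unique up down))))

    down-forever : ∀ {j} r → j + r < ℓ →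
      ChildOf (F j) (F (suc j)) → ChildOf (F (j + r)) (F (suc (j + r)))
    down-forever {j} zero _ down = subst (λ i → ChildOf (F i) (F (suc i))) (sym (+-identityʳ j)) down
    down-forever {j} (suc r) lt down = subst (λ i → ChildOf (F i) (F (suc i))) (sym (+-suc j r))
      (down-persists (subst (_< ℓ) (+-suc j r) lt)
        (down-forever r (<-trans (+-monoʳ-< j (n<1+n r)) lt) down))

    depth-after-down : ∀ {j} r → j + r ≤ ℓ →
      ChildOf (F j) (F (suc j)) → depth (F (j + r)) ≡ depth (F j) + r
    depth-after-down {j} zero _ _ = trans (cong (λ i → depth (F i)) (+-identityʳ j)) (sym (+-identityʳ _))
    depth-after-down {j} (suc r) le down = begin
      depth (F (j + suc r))      ≡⟨ cong (λ i → depth (F i)) (+-suc j r) ⟩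
      depth (F (suc (j + r)))    ≡⟨ child-depth (down-forever r lt down) ⟩
      suc (depth (F (j + r)))    ≡⟨ cong suc (depth-after-down r (<⇒≤ lt) down) ⟩
      suc (depth (F j) + r)      ≡⟨ +-suc _ r ⟨
      depth (F j) + suc r        ∎
      where
      open ≡-Reasoning
      lt : j + r < ℓ
      lt = subst (_≤ ℓ) (+-suc j r) le

    climb-step : ∀ {j} → j < h → depth (F j) + j ≡ n → ChildOf (F (suc j)) (F j)
    climb-step {j} j<h d+j≡n with F-adj (≤-trans j<h h≤ℓ)
    ... | inj₂ up = up
    ... | inj₁ down = ⊥-elim (<⇒≱ j<ℓ∸j (+-cancelˡ-≤ (depth (F j)) _ _ (begin
          depth (F j) + (ℓ ∸ j)   ≡⟨ depth-after-down (ℓ ∸ j) (≤-reflexive j+[ℓ∸j]≡ℓ) down ⟨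
          depth (F (j + (ℓ ∸ j))) ≤⟨ depth≤n _ ⟩
          n                       ≡⟨ d+j≡n ⟨
          depth (F j) + j         ∎)))
      where
      open ≤-Reasoning
      j+[ℓ∸j]≡ℓ : j + (ℓ ∸ j) ≡ ℓ
      j+[ℓ∸j]≡ℓ = m+[n∸m]≡n (<⇒≤ (≤-trans j<h h≤ℓ))
      j<ℓ∸j : j < ℓ ∸ j
      j<ℓ∸j = m+n≤o⇒m≤o∸n (suc j) (subst (suc j + j ≤_) (sym ℓ≡h+h) (+-mono-≤ j<h (<⇒≤ j<h)))

    climb-depth : ∀ j → j ≤ h → depth (F j) + j ≡ n
    climb-depth zero _ = trans (+-identityʳ _) start
    climb-depth (suc j) j<h = begin
      depth (F (suc j)) + suc j  ≡⟨ +-suc _ j ⟩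
      suc (depth (F (suc j))) + j ≡⟨ cong (_+ j) (child-depth (climb-step j<h IH)) ⟨
      depth (F j) + j            ≡⟨ IH ⟩
      n                          ∎
      where
      open ≡-Reasoning
      IH : depth (F j) + j ≡ n
      IH = climb-depth j (<⇒≤ j<h)

    climb : ∀ j → j ≤ h → F j ≡ ancestor (F 0) (n ∸ j)
    climb zero _ = sym (trans (cong (ancestor (F 0)) (sym start)) (ancestor-depth (F 0)))
    climb (suc j) j<h = begin
      F (suc j)                                      ≡⟨ ancestor≡parent up ⟨
      ancestor (F j) (depth (F (suc j)))             ≡⟨ cong₂ ancestor (climb j (<⇒≤ j<h)) depth≡ ⟩
      ancestor (ancestor (F 0) (n ∸ j)) (n ∸ suc j)  ≡⟨ ancestor-ancestor (F 0) (∸-monoʳ-≤ n (n≤1+n j)) n∸j≤ ⟩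
      ancestor (F 0) (n ∸ suc j)                     ∎
      where
      open ≡-Reasoning
      up : ChildOf (F (suc j)) (F j)
      up = climb-step j<h (climb-depth j (<⇒≤ j<h))
      n∸j≤ : n ∸ j ≤ depth (F 0)
      n∸j≤ = subst (n ∸ j ≤_) (sym start) (m∸n≤m n j)
      depth≡ : depth (F (suc j)) ≡ n ∸ suc j
      depth≡ = trans (sym (m+n∸n≡m _ (suc j))) (cong (_∸ suc j) (climb-depth (suc j) j<h))

  ancestor-∸-child : ∀ w → depth w ≡ n → ∀ {j} → suc j ≤ n →
    ChildOf (ancestor w (n ∸ suc j)) (ancestor w (n ∸ j))
  ancestor-∸-child w dw {j} j<n =
    subst (λ t → ChildOf (ancestor w (n ∸ suc j)) (ancestor w t)) (sym (+-∸-assoc 1 j<n))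
      (ancestor-child w (subst (n ∸ suc j <_) (sym dw) (∸-monoʳ-< {o = 0} (s≤s z≤n) j<n)))

  ancestor-∸-injective : ∀ w → depth w ≡ n → ∀ {i j} → i ≤ n → j ≤ n →
    ancestor w (n ∸ i) ≡ ancestor w (n ∸ j) → i ≡ j
  ancestor-∸-injective w dw {i} {j} i≤n j≤n eq = ∸-cancelˡ-≡ i≤n j≤n
    (ancestor-injective w (subst (n ∸ i ≤_) (sym dw) (m∸n≤m n i)) (subst (n ∸ j ≤_) (sym dw) (m∸n≤m n j)) eq)

  LeafPairSplitAt : ℕ → V × V → Set
  LeafPairSplitAt d (u , v) =
    depth u ≡ n × depth v ≡ n × ancestor u d ≡ ancestor v d × ancestor u (suc d) ≢ ancestor v (suc d)

  apart-below-split : ∀ {d u v t} → LeafPairSplitAt d (u , v) → suc d ≤ t → t ≤ n →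
    ancestor u t ≢ ancestor v t
  apart-below-split {d} {u} {v} {t} (du , dv , _ , apart) d<t t≤n eq = apart (begin
    ancestor u (suc d)                ≡⟨ ancestor-ancestor u d<t (subst (t ≤_) (sym du) t≤n) ⟨
    ancestor (ancestor u t) (suc d)   ≡⟨ cong (λ w → ancestor w (suc d)) eq ⟩
    ancestor (ancestor v t) (suc d)   ≡⟨ ancestor-ancestor v d<t (subst (t ≤_) (sym dv) t≤n) ⟩
    ancestor v (suc d)                ∎)
    where open ≡-Reasoning

  module Split {d h′ : ℕ} (n≡d+h : n ≡ d + suc h′) where

    h ℓ : ℕ
    h = suc h′
    ℓ = h + h

    private
      h≤n : h ≤ n
      h≤n = subst (h ≤_) (sym n≡d+h) (m≤n+m h d)
      n∸h≡d : n ∸ h ≡ d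
      n∸h≡d = trans (cong (_∸ h) n≡d+h) (m+n∸n≡m d h)
      n∸h′≡1+d : n ∸ h′ ≡ suc d
      n∸h′≡1+d = trans (cong (_∸ h′) (trans n≡d+h (+-suc d h′))) (m+n∸n≡m (suc d) h′)
      ℓ∸h≡h : ℓ ∸ h ≡ h
      ℓ∸h≡h = m+n∸n≡m h h
      ℓ∸j≤h : ∀ {j} → ¬ j ≤ h → ℓ ∸ j ≤ h
      ℓ∸j≤h {j} j≰h = subst (ℓ ∸ j ≤_) ℓ∸h≡h (∸-monoʳ-≤ ℓ (<⇒≤ (≰⇒> j≰h)))

    canonical : V → V → ℕ → V
    canonical u v j with j ≤? h
    ... | yes _ = ancestor u (n ∸ j)
    ... | no _  = ancestor v (n ∸ (ℓ ∸ j))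

    module _ {F : ℕ → V} (path : IsPathFn ℓ F) (start : depth (F 0) ≡ n) (end : depth (F ℓ) ≡ n) where
      private
        module Fwd = Climb {ℓ} {h} refl path start
        module Bwd = Climb {ℓ} {h} refl (reverse-IsPathFn path) end

      leafPath-splits : LeafPairSplitAt d (F 0 , F ℓ)
      leafPath-splits = start , end , meet , apart
        where
        open ≡-Reasoning
        meet : ancestor (F 0) d ≡ ancestor (F ℓ) d
        meet = begin
          ancestor (F 0) d        ≡⟨ cong (ancestor (F 0)) n∸h≡d ⟨
          ancestor (F 0) (n ∸ h)  ≡⟨ Fwd.climb h ≤-refl ⟨
          F h                     ≡⟨ cong F ℓ∸h≡h ⟨
          F (ℓ ∸ h)               ≡⟨ Bwd.climb h ≤-refl ⟩
          ancestor (F ℓ) (n ∸ h)  ≡⟨ cong (ancestor (F ℓ)) n∸h≡d ⟩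
          ancestor (F ℓ) d        ∎
        apart : ancestor (F 0) (suc d) ≢ ancestor (F ℓ) (suc d)
        apart eq = <⇒≢ h′<ℓ∸h′ (proj₁ path h′≤ℓ (m∸n≤m ℓ h′) (begin
          F h′                      ≡⟨ Fwd.climb h′ (n≤1+n h′) ⟩
          ancestor (F 0) (n ∸ h′)   ≡⟨ cong (ancestor (F 0)) n∸h′≡1+d ⟩
          ancestor (F 0) (suc d)    ≡⟨ eq ⟩
          ancestor (F ℓ) (suc d)    ≡⟨ cong (ancestor (F ℓ)) n∸h′≡1+d ⟨
          ancestor (F ℓ) (n ∸ h′)   ≡⟨ Bwd.climb h′ (n≤1+n h′) ⟨
          F (ℓ ∸ h′)                ∎))
          where
          h′≤ℓ : h′ ≤ ℓ
          h′≤ℓ = ≤-trans (n≤1+n h′) (m≤m+n h h)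
          h′<ℓ∸h′ : h′ < ℓ ∸ h′
          h′<ℓ∸h′ = m+n≤o⇒m≤o∸n (suc h′) (+-monoʳ-≤ h (n≤1+n h′))

      leafPath-canonical : ∀ j → j ≤ ℓ → F j ≡ canonical (F 0) (F ℓ) j
      leafPath-canonical j j≤ℓ with j ≤? h
      ... | yes j≤h = Fwd.climb j j≤h
      ... | no j≰h = trans (cong F (sym (m∸[m∸n]≡n j≤ℓ))) (Bwd.climb (ℓ ∸ j) (ℓ∸j≤h j≰h))

    module _ {u v : V} (split : LeafPairSplitAt d (u , v)) where
      private
        du : depth u ≡ n
        du = proj₁ split
        dv : depth v ≡ n
        dv = proj₁ (proj₂ split)
        meet : ancestor u d ≡ ancestor v d
        meet = proj₁ (proj₂ (proj₂ split))

      canonical-start : canonical u v 0 ≡ u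
      canonical-start = trans (cong (ancestor u) (sym du)) (ancestor-depth u)

      canonical-end : canonical u v ℓ ≡ v
      canonical-end with ℓ ≤? h
      ... | yes ℓ≤h = ⊥-elim (<⇒≱ (m<m+n h (s≤s z≤n)) ℓ≤h)
      ... | no _ =
        trans (cong (λ t → ancestor v (n ∸ t)) (n∸n≡0 ℓ)) (trans (cong (ancestor v) (sym dv)) (ancestor-depth v))

      canonical-adj : ∀ {j} → j < ℓ → Adj (canonical u v j) (canonical u v (suc j))
      canonical-adj {j} j<ℓ with j ≤? h | suc j ≤? h
      ... | yes _ | yes j<h = inj₂ (ancestor-∸-child u du (≤-trans j<h h≤n))
      ... | no j≰h | yes j<h = ⊥-elim (j≰h (<⇒≤ j<h))
      ... | no j≰h | no _ =
        inj₁ (subst (λ t → ChildOf (ancestor v (n ∸ t)) (ancestor v (n ∸ (ℓ ∸ suc j)))) (sym 1+ℓ∸1+j)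
          (ancestor-∸-child v dv {ℓ ∸ suc j} (subst (_≤ n) 1+ℓ∸1+j (≤-trans (ℓ∸j≤h j≰h) h≤n))))
        where
        1+ℓ∸1+j : ℓ ∸ j ≡ suc (ℓ ∸ suc j)
        1+ℓ∸1+j = +-∸-assoc 1 j<ℓ
      ... | yes j≤h | no j≮h with refl ← ≤-antisym j≤h (≮⇒≥ j≮h) = inj₁ (subst₂ ChildOf
            (sym (trans (cong (ancestor u) n∸h≡d) meet))
            (cong (ancestor v) (sym (trans (cong (n ∸_) (m+n∸n≡m h′ h)) n∸h′≡1+d)))
            (ancestor-child v (subst (d <_) (sym dv) d<n)))
        where
        d<n : d < n
        d<n = subst (d <_) (sym n≡d+h) (m<m+n d (s≤s z≤n))

      crossing : ∀ {i j} → i ≤ h → j ≤ ℓ → ¬ j ≤ h →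
        ancestor u (n ∸ i) ≢ ancestor v (n ∸ (ℓ ∸ j))
      crossing {i} {j} i≤h j≤ℓ j≰h eq = apart-below-split split 1+d≤t (m∸n≤m n (ℓ ∸ j)) (begin
        ancestor u t        ≡⟨ cong (ancestor u) n∸i≡t ⟨
        ancestor u (n ∸ i)  ≡⟨ eq ⟩
        ancestor v t        ∎)
        where
        open ≡-Reasoning
        t : ℕ
        t = n ∸ (ℓ ∸ j)
        1+d≤t : suc d ≤ t
        1+d≤t = subst (_≤ t) n∸h′≡1+d
          (∸-monoʳ-≤ n (s≤s⁻¹ (subst (ℓ ∸ j <_) ℓ∸h≡h (∸-monoʳ-< (≰⇒> j≰h) j≤ℓ))))
        n∸i≡t : n ∸ i ≡ t
        n∸i≡t = trans (sym (depth-ancestor u (subst (n ∸ i ≤_) (sym du) (m∸n≤m n i))))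
                  (trans (cong depth eq) (depth-ancestor v (subst (t ≤_) (sym dv) (m∸n≤m n (ℓ ∸ j)))))

      canonical-injective : ∀ {i j} → i ≤ ℓ → j ≤ ℓ → canonical u v i ≡ canonical u v j → i ≡ j
      canonical-injective {i} {j} i≤ℓ j≤ℓ eq with i ≤? h | j ≤? h
      ... | yes i≤h | yes j≤h = ancestor-∸-injective u du (≤-trans i≤h h≤n) (≤-trans j≤h h≤n) eq
      ... | no i≰h | no j≰h = ∸-cancelˡ-≡ i≤ℓ j≤ℓ
            (ancestor-∸-injective v dv (≤-trans (ℓ∸j≤h i≰h) h≤n) (≤-trans (ℓ∸j≤h j≰h) h≤n) eq)
      ... | yes i≤h | no j≰h = ⊥-elim (crossing i≤h j≤ℓ j≰h eq)
      ... | no i≰h | yes j≤h = ⊥-elim (crossing j≤h i≤ℓ i≰h (sym eq))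

    pathOf : V × V → Vec V (suc ℓ)
    pathOf (u , v) = tabulate (canonical u v ∘ toℕ)

    private
      0<n : 0 < n
      0<n = ≤-trans (s≤s z≤n) h≤n
      lookup-pathOf : ∀ {u v} i {j} → toℕ i ≡ j → lookup (pathOf (u , v)) i ≡ canonical u v j
      lookup-pathOf {u} {v} i refl = lookup∘tabulate (canonical u v ∘ toℕ) i

    module _ {u v : V} (split : LeafPairSplitAt d (u , v)) where

      pathOf-start : lookup (pathOf (u , v)) fzero ≡ u
      pathOf-start = trans (lookup-pathOf {u} {v} fzero refl) (canonical-start split)

      pathOf-end : lookup (pathOf (u , v)) (fromℕ ℓ) ≡ v
      pathOf-end = trans (lookup-pathOf {u} {v} (fromℕ ℓ) (toℕ-fromℕ ℓ)) (canonical-end split)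

      pathOf-IsLeafPath : IsLeafPath ℓ (pathOf (u , v))
      pathOf-IsLeafPath = (inj , adj) , leaf-start , leaf-end
        where
        inj : ∀ {i j} → lookup (pathOf (u , v)) i ≡ lookup (pathOf (u , v)) j → i ≡ j
        inj {i} {j} eq = toℕ-injective (canonical-injective split (toℕ≤pred[n] i) (toℕ≤pred[n] j)
          (trans (sym (lookup-pathOf i refl)) (trans eq (lookup-pathOf j refl))))
        adj : ∀ i → Adj (lookup (pathOf (u , v)) (inject₁ i)) (lookup (pathOf (u , v)) (fsuc i))
        adj i = subst₂ Adj (sym (lookup-pathOf (inject₁ i) (toℕ-inject₁ i)))
          (sym (lookup-pathOf (fsuc i) refl)) (canonical-adj split (toℕ<n i))
        leaf-start : Leaf (lookup (pathOf (u , v)) fzero)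
        leaf-start = subst Leaf (sym pathOf-start) (depth≡n⇒Leaf 0<n u (proj₁ split))
        leaf-end : Leaf (lookup (pathOf (u , v)) (fromℕ ℓ))
        leaf-end = subst Leaf (sym pathOf-end) (depth≡n⇒Leaf 0<n v (proj₁ (proj₂ split)))

    count-leafPaths : ∀ {M} → HasCount (LeafPairSplitAt d) M → HasCount (IsLeafPath ℓ) M
    count-leafPaths = HasCount-map pathOf inj (λ _ → pathOf-IsLeafPath) onto
      where
      inj : ∀ {p q} → LeafPairSplitAt d p → LeafPairSplitAt d q → pathOf p ≡ pathOf q → p ≡ q
      inj sp sq eq = cong₂ _,_
        (trans (sym (pathOf-start sp)) (trans (cong (λ w → lookup w fzero) eq) (pathOf-start sq)))
        (trans (sym (pathOf-end sp)) (trans (cong (λ w → lookup w (fromℕ ℓ)) eq) (pathOf-end sq)))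
      onto : ∀ w → IsLeafPath ℓ w → ∃ λ p → LeafPairSplitAt d p × pathOf p ≡ w
      onto w (w-path , leaf-start , leaf-end) =
        (at w 0 , at w ℓ) , leafPath-splits path start end ,
        trans (tabulate-cong λ i → trans (sym (leafPath-canonical path start end (toℕ i) (toℕ≤pred[n] i)))
                                         (at-lookup w i refl))
              (tabulate∘lookup w)
        where
        path : IsPathFn ℓ (at w)
        path = IsPath⇒IsPathFn w-path
        start : depth (at w 0) ≡ n
        start = Leaf⇒depth≡n 0<n (at w 0) (subst Leaf (sym (at-lookup w fzero refl)) leaf-start)
        end : depth (at w ℓ) ≡ n
        end = Leaf⇒depth≡n 0<n (at w ℓ) (subst Leaf (sym (at-lookup w (fromℕ ℓ) (toℕ-fromℕ ℓ))) leaf-end)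

  -- Counting leaf pairs by the depth of their lowest common ancestor

  ancestor-node-++ : ∀ {i xs p} pre post {t} → xs ≡ pre ++ post → length post ≡ t →
    ∃ λ q → ancestor (node i xs p) (suc t) ≡ node i post q
  ancestor-node-++ {xs = xs} {p} pre post refl refl =
    ≤-trans (s≤s (length-++-≤ʳ post {pre})) p , node-cong refl (begin
      drop (length xs ∸ length post) xs  ≡⟨ cong (λ r → drop r xs) |xs|∸|post|≡|pre| ⟩
      drop (length pre) (pre ++ post)    ≡⟨ drop-length-++ pre post ⟩
      post                               ∎)
    where
    open ≡-Reasoning
    |xs|∸|post|≡|pre| : length xs ∸ length post ≡ length pre
    |xs|∸|post|≡|pre| = trans (cong (_∸ length post) (length-++ pre)) (m+n∸n≡m (length pre) (length post))

  ancestors-agree : ∀ {i j xs ys p q} pre post pre′ post′ {t} → xs ≡ pre ++ post → ys ≡ pre′ ++ post′ →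
    length post ≡ t → length post′ ≡ t →
    ancestor (node i xs p) (suc t) ≡ ancestor (node j ys q) (suc t) ⇔ (i ≡ j × post ≡ post′)
  ancestors-agree pre post pre′ post′ xs≡ ys≡ |post| |post′|
    with _ , eq ← ancestor-node-++ pre post xs≡ |post| | _ , eq′ ← ancestor-node-++ pre′ post′ ys≡ |post′| =
    mk⇔ (λ agree → node-injective (trans (sym eq) (trans agree eq′)))
        (λ { (refl , refl) → trans eq (trans (node-cong refl refl) (sym eq′)) })

  module _ {n′ : ℕ} (n≡1+n′ : n ≡ suc n′) where
    private
      depth-leaf : ∀ (xs : Vec Step n′) → suc (length (toList xs)) ≡ n
      depth-leaf xs = trans (cong suc (length-toList xs)) (sym n≡1+n′)

      leaf : FirstStep → Vec Step n′ → V
      leaf i xs = node i (toList xs) (≤-reflexive (depth-leaf xs))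

      apart-iff : ∀ {i j} xs ys {p q} → ancestor (node i xs p) 1 ≡ ancestor (node j ys q) 1 ⇔ (i ≡ j × [] ≡ [])
      apart-iff xs ys = ancestors-agree xs [] ys [] (sym (++-identityʳ xs)) (sym (++-identityʳ ys)) refl refl

      -- Two distinct children of the root, then the remaining n′ steps towards each leaf.
      Source : Set
      Source = (FirstStep × FirstStep) × (Vec Step n′ × Vec Step n′)

      Admissible : Source → Set
      Admissible = uncurry _≢_ ⟨×⟩ U ⟨×⟩ U

      pair : Source → V × V
      pair ((a , b) , (xs , ys)) = leaf a xs , leaf b ys

    count-split-at-root : HasCount (LeafPairSplitAt 0) ((suc (suc m) * suc m) * (suc m ^ n′ * suc m ^ n′))
    count-split-at-root = HasCount-map pair inj splits onto
      (HasCount-× (HasCount-≢ (suc m)) (HasCount-× (HasCount-Vec (HasCount-Fin _) n′)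
                                                    (HasCount-Vec (HasCount-Fin _) n′)))
      where
      inj : ∀ {s s′} → Admissible s → Admissible s′ → pair s ≡ pair s′ → s ≡ s′
      inj {(a , b) , (xs , ys)} {(a′ , b′) , (xs′ , ys′)} _ _ eq
        with refl , xs≡ ← node-injective (cong proj₁ eq) | refl , ys≡ ← node-injective (cong proj₂ eq) =
        cong₂ (λ xs ys → (a , b) , (xs , ys)) (toList-injective-≡ xs≡) (toList-injective-≡ ys≡)
      splits : ∀ s → Admissible s → LeafPairSplitAt 0 (pair s)
      splits ((a , b) , (xs , ys)) (a≢b , _) =
        depth-leaf xs , depth-leaf ys , refl , a≢b ∘ proj₁ ∘ Equivalence.to (apart-iff (toList xs) (toList ys))
      onto : ∀ p → LeafPairSplitAt 0 p → ∃ λ s → Admissible s × pair s ≡ p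
      onto (root , _) (d≡n , _) = ⊥-elim (1+n≢0 (sym (trans d≡n n≡1+n′)))
      onto (node _ _ _ , root) (_ , d≡n , _) = ⊥-elim (1+n≢0 (sym (trans d≡n n≡1+n′)))
      onto (node a xs p , node b ys q) (du , dv , _ , apart) =
        ((a , b) , (proj₁ xs′ , proj₁ ys′)) , (a≢b , _) ,
        cong₂ _,_ (node-cong refl (proj₂ xs′)) (node-cong refl (proj₂ ys′))
        where
        xs′ : ∃ λ (zs : Vec Step n′) → toList zs ≡ xs
        xs′ = toList-preimage xs (suc-injective (trans du n≡1+n′))
        ys′ : ∃ λ (zs : Vec Step n′) → toList zs ≡ ys
        ys′ = toList-preimage ys (suc-injective (trans dv n≡1+n′))
        a≢b : a ≢ b
        a≢b a≡b = apart (Equivalence.from (apart-iff xs ys) (a≡b , refl))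

  module _ {d′ h′ : ℕ} (n≡d+h : n ≡ suc d′ + suc h′) where
    private
      n≡1+h′+1+d′ : n ≡ suc (h′ + suc d′)
      n≡1+h′+1+d′ = trans n≡d+h (cong suc (trans (+-suc d′ h′) (trans (cong suc (+-comm d′ h′))
                                                                   (sym (+-suc h′ d′)))))

      depth-leaf : ∀ (as : Vec Step h′) a (zs : Vec Step d′) → suc (length (toList as ++ a ∷ toList zs)) ≡ n
      depth-leaf as a zs = begin
        suc (length (toList as ++ a ∷ toList zs))          ≡⟨ cong suc (length-++ (toList as)) ⟩
        suc (length (toList as) + suc (length (toList zs)))
          ≡⟨ cong₂ (λ x y → suc (x + suc y)) (length-toList as) (length-toList zs) ⟩
        suc (h′ + suc d′)                                   ≡⟨ n≡1+h′+1+d′ ⟨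
        n                                                   ∎
        where open ≡-Reasoning

      same-length : ∀ (xs ys : Vec Step h′) → length (toList xs) ≡ length (toList ys)
      same-length xs ys = trans (length-toList xs) (sym (length-toList ys))

      leaf : FirstStep → Vec Step h′ → Step → Vec Step d′ → V
      leaf i as a zs = node i (toList as ++ a ∷ toList zs) (≤-reflexive (depth-leaf as a zs))

      meet-iff : ∀ {i j} pre a post pre′ b post′ {p q} → length post ≡ d′ → length post′ ≡ d′ →
        ancestor (node i (pre ++ a ∷ post) p) (suc d′) ≡ ancestor (node j (pre′ ++ b ∷ post′) q) (suc d′)
          ⇔ (i ≡ j × post ≡ post′)
      meet-iff pre a post pre′ b post′ =
        ancestors-agree (pre ++ a ∷ []) post (pre′ ++ b ∷ []) post′
          (sym (++-assoc pre _ _)) (sym (++-assoc pre′ _ _))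

      apart-iff : ∀ {i j} pre a post pre′ b post′ {p q} → length post ≡ d′ → length post′ ≡ d′ →
        ancestor (node i (pre ++ a ∷ post) p) (suc (suc d′))
          ≡ ancestor (node j (pre′ ++ b ∷ post′) q) (suc (suc d′)) ⇔ (i ≡ j × a ∷ post ≡ b ∷ post′)
      apart-iff pre a post pre′ b post′ |post| |post′| =
        ancestors-agree pre (a ∷ post) pre′ (b ∷ post′) refl refl (cong suc |post|) (cong suc |post′|)

      -- The first step and the d′ further steps to the common ancestor, two distinct steps out
      -- of it, and the h′ remaining steps towards each leaf (step lists are stored bottom-up).
      Source : Set
      Source = FirstStep × Vec Step d′ × (Step × Step) × Vec Step h′ × Vec Step h′

      Admissible : Source → Set
      Admissible = U ⟨×⟩ U ⟨×⟩ uncurry _≢_ ⟨×⟩ U ⟨×⟩ U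

      pair : Source → V × V
      pair (i , zs , (a , b) , as , bs) = leaf i as a zs , leaf i bs b zs

    count-split-below-root :
      HasCount (LeafPairSplitAt (suc d′)) (suc (suc m) * (suc m ^ d′ * ((suc m * m) * (suc m ^ h′ * suc m ^ h′))))
    count-split-below-root = HasCount-map pair inj splits onto
      (HasCount-× (HasCount-Fin _) (HasCount-× (HasCount-Vec (HasCount-Fin _) d′)
        (HasCount-× (HasCount-≢ m) (HasCount-× (HasCount-Vec (HasCount-Fin _) h′)
                                               (HasCount-Vec (HasCount-Fin _) h′)))))
      where
      inj : ∀ {s s′} → Admissible s → Admissible s′ → pair s ≡ pair s′ → s ≡ s′
      inj {i , zs , (a , b) , as , bs} {i′ , zs′ , (a′ , b′) , as′ , bs′} _ _ eq
        with refl , u≡ ← node-injective (cong proj₁ eq) | _ , v≡ ← node-injective (cong proj₂ eq)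
        with as≡ , azs≡ ← ++-cancel-equal-length (toList as) (toList as′) (same-length as as′) u≡
           | bs≡ , bzs≡ ← ++-cancel-equal-length (toList bs) (toList bs′) (same-length bs bs′) v≡
        with refl , zs≡ ← ∷-injective azs≡ | refl , _ ← ∷-injective bzs≡
        with refl ← toList-injective-≡ {xs = zs} zs≡
           | refl ← toList-injective-≡ {xs = as} as≡
           | refl ← toList-injective-≡ {xs = bs} bs≡ = refl
      splits : ∀ s → Admissible s → LeafPairSplitAt (suc d′) (pair s)
      splits (i , zs , (a , b) , as , bs) (_ , _ , a≢b , _) =
        depth-leaf as a zs , depth-leaf bs b zs ,
        Equivalence.from (meet-iff (toList as) a (toList zs) (toList bs) b (toList zs) |zs| |zs|) (refl , refl) ,
        λ eq → a≢b (proj₁ (∷-injective (proj₂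
          (Equivalence.to (apart-iff (toList as) a (toList zs) (toList bs) b (toList zs) |zs| |zs|) eq))))
        where
        |zs| : length (toList zs) ≡ d′
        |zs| = length-toList zs
      onto : ∀ p → LeafPairSplitAt (suc d′) p → ∃ λ s → Admissible s × pair s ≡ p
      onto (root , _) (d≡n , _) = ⊥-elim (1+n≢0 (sym (trans d≡n n≡d+h)))
      onto (node _ _ _ , root) (_ , d≡n , _) = ⊥-elim (1+n≢0 (sym (trans d≡n n≡d+h)))
      onto (node i xs p , node j ys q) (du , dv , meet , apart)
        with pre , a , post , |pre| , |post| , refl ← split-at h′ xs (suc-injective (trans du n≡1+h′+1+d′))
           | pre′ , b , post′ , |pre′| , |post′| , refl ← split-at h′ ys (suc-injective (trans dv n≡1+h′+1+d′))
        with refl , refl ← Equivalence.to (meet-iff pre a post pre′ b post′ |post| |post′|) meet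
        = (i , proj₁ zs , (a , b) , proj₁ as , proj₁ bs) , (_ , _ , a≢b , _ , _) ,
          cong₂ _,_ (node-cong refl (cong₂ (λ xs ys → xs ++ a ∷ ys) (proj₂ as) (proj₂ zs)))
                    (node-cong refl (cong₂ (λ xs ys → xs ++ b ∷ ys) (proj₂ bs) (proj₂ zs)))
        where
        zs : ∃ λ (zs : Vec Step d′) → toList zs ≡ post
        zs = toList-preimage post |post|
        as : ∃ λ (as : Vec Step h′) → toList as ≡ pre
        as = toList-preimage pre |pre|
        bs : ∃ λ (bs : Vec Step h′) → toList bs ≡ pre′
        bs = toList-preimage pre′ |pre′|
        a≢b : a ≢ b
        a≢b refl = apart (Equivalence.from (apart-iff pre a post pre′ a post |post| |post′|) (refl , refl))

  count-leafPaths-maximal : ∀ {n′} → n ≡ suc n′ →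
    HasCount (IsLeafPath (suc n′ + suc n′)) ((suc (suc m) * suc m) * (suc m ^ n′ * suc m ^ n′))
  count-leafPaths-maximal n≡1+n′ = Split.count-leafPaths {0} n≡1+n′ (count-split-at-root n≡1+n′)

  count-leafPaths-below-maximal : ∀ {d′ h′} → n ≡ suc d′ + suc h′ →
    HasCount (IsLeafPath (suc h′ + suc h′))
             (suc (suc m) * (suc m ^ d′ * ((suc m * m) * (suc m ^ h′ * suc m ^ h′))))
  count-leafPaths-below-maximal n≡d+h = Split.count-leafPaths n≡d+h (count-split-below-root n≡d+h)

2*[nC2]≡n*[n∸1] : ∀ t → 2 * (t C 2) ≡ t * (t ∸ 1)
2*[nC2]≡n*[n∸1] zero = refl
2*[nC2]≡n*[n∸1] (suc zero) = refl
2*[nC2]≡n*[n∸1] (suc (suc t)) = begin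
  2 * (suc (suc t) C 2)         ≡⟨ cong (2 *_) (nCk+nC[k+1]≡[n+1]C[k+1] (suc t) 1) ⟨
  2 * (suc t C 1 + suc t C 2)   ≡⟨ cong (λ c → 2 * (c + suc t C 2)) (nC1≡n (suc t)) ⟩
  2 * (suc t + suc t C 2)       ≡⟨ *-distribˡ-+ 2 (suc t) (suc t C 2) ⟩
  2 * suc t + 2 * (suc t C 2)   ≡⟨ cong (2 * suc t +_) (2*[nC2]≡n*[n∸1] (suc t)) ⟩
  2 * suc t + suc t * t         ≡⟨ expand t ⟩
  suc (suc t) * suc t           ∎
  where
  open ≡-Reasoning
  expand : ∀ t → 2 * suc t + suc t * t ≡ suc (suc t) * suc t
  expand = solve-∀

maximal-count≡ : ∀ m n′ → let k = suc (suc m); K = suc m in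
  (k * K) * (K ^ n′ * K ^ n′) ≡ 2 * (K ^ (suc n′ * 2 ∸ 2) * (k C 2))
maximal-count≡ m n′ = begin
  (k * K) * (K ^ n′ * K ^ n′)          ≡⟨ cong (_* (K ^ n′ * K ^ n′)) (2*[nC2]≡n*[n∸1] k) ⟨
  (2 * (k C 2)) * (K ^ n′ * K ^ n′)    ≡⟨ rearrange (K ^ n′) (k C 2) ⟩
  2 * ((K ^ n′ * K ^ n′) * (k C 2))    ≡⟨ cong (λ p → 2 * (p * (k C 2))) powers ⟨
  2 * (K ^ (n′ * 2) * (k C 2))         ∎
  where
  open ≡-Reasoning
  k K : ℕ
  k = suc (suc m)
  K = suc m
  rearrange : ∀ P C → (2 * C) * (P * P) ≡ 2 * ((P * P) * C)
  rearrange = solve-∀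
  powers : K ^ (n′ * 2) ≡ K ^ n′ * K ^ n′
  powers = trans (cong (K ^_) (trans (*-comm n′ 2) (cong (n′ +_) (+-identityʳ n′)))) (^-distribˡ-+-* K n′ n′)

below-maximal-count≡ : ∀ m d′ h′ → let k = suc (suc m); K = suc m in
  k * (K ^ d′ * ((K * m) * (K ^ h′ * K ^ h′))) ≡ 2 * (k * K ^ ((suc d′ + suc h′) + suc h′ ∸ 3) * (K C 2))
below-maximal-count≡ m d′ h′ = begin
  k * (K ^ d′ * ((K * m) * (K ^ h′ * K ^ h′)))
    ≡⟨ cong (λ c → k * (K ^ d′ * (c * (K ^ h′ * K ^ h′)))) (2*[nC2]≡n*[n∸1] K) ⟨
  k * (K ^ d′ * ((2 * (K C 2)) * (K ^ h′ * K ^ h′))) ≡⟨ rearrange k (K ^ d′) (K ^ h′) (K C 2) ⟩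
  2 * (k * (K ^ d′ * (K ^ h′ * K ^ h′)) * (K C 2))   ≡⟨ cong (λ p → 2 * (k * p * (K C 2))) powers ⟨
  2 * (k * K ^ (d′ + (h′ + h′)) * (K C 2))           ≡⟨ cong (λ e → 2 * (k * K ^ e * (K C 2))) exponent ⟨
  2 * (k * K ^ ((suc d′ + suc h′) + suc h′ ∸ 3) * (K C 2)) ∎
  where
  open ≡-Reasoning
  k K : ℕ
  k = suc (suc m)
  K = suc m
  rearrange : ∀ k A B C → k * (A * ((2 * C) * (B * B))) ≡ 2 * (k * (A * (B * B)) * C)
  rearrange = solve-∀
  powers : K ^ (d′ + (h′ + h′)) ≡ K ^ d′ * (K ^ h′ * K ^ h′)
  powers = trans (^-distribˡ-+-* K d′ (h′ + h′)) (cong (K ^ d′ *_) (^-distribˡ-+-* K h′ h′))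
  regroup : ∀ d h → (suc d + suc h) + suc h ≡ 3 + (d + (h + h))
  regroup = solve-∀
  exponent : (suc d′ + suc h′) + suc h′ ∸ 3 ≡ d′ + (h′ + h′)
  exponent = trans (cong (_∸ 3) (regroup d′ h′)) (m+n∸m≡n 3 _)

halve-≤ : ∀ {h n} → h * 2 ≤ 2 * suc n ∸ 2 → h ≤ n
halve-≤ {h} {n} le = *-cancelˡ-≤ 2 (subst₂ _≤_ (*-comm h 2) (sym (*-distribˡ-∸ 2 (suc n) 1)) le)

lemma2 : (n k ℓ : ℕ) → 1 ≤ n → 2 ≤ k → 2 ∣ ℓ → 2 ≤ ℓ → ℓ ≤ 2 * n →
    (ℓ ≤ 2 * n ∸ 2 → LeafPathCount n k ℓ (k * (k ∸ 1) ^ (n + ℓ / 2 ∸ 3) * ((k ∸ 1) C 2)))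
    × (ℓ ≡ 2 * n → LeafPathCount n k ℓ ((k ∸ 1) ^ (ℓ ∸ 2) * (k C 2)))
lemma2 (suc n′) (suc (suc m)) .(0 * 2) _ _ (divides zero refl) () _
lemma2 (suc n′) (suc (suc m)) .(suc h′ * 2) (s≤s z≤n) (s≤s (s≤s z≤n)) (divides (suc h′) refl) _ _ =
  below-maximal , maximal
  where
  open Dendrimer (suc n′) m
  h : ℕ
  h = suc h′
  Count : ℕ → ℕ → Set
  Count ℓ N = HasCount (IsLeafPath {suc n′} {suc (suc m)} ℓ) N
  ℓ≡h+h : h * 2 ≡ h + h
  ℓ≡h+h = trans (*-comm h 2) (cong (h +_) (+-identityʳ h))

  below-maximal : h * 2 ≤ 2 * suc n′ ∸ 2 →
    Count (h * 2) (2 * (suc (suc m) * suc m ^ (suc n′ + h * 2 / 2 ∸ 3) * (suc m C 2)))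
  below-maximal ℓ≤2n∸2 = subst₂ Count (sym ℓ≡h+h)
    (trans (below-maximal-count≡ m d′ h′) (cong (λ e → 2 * (suc (suc m) * suc m ^ (e ∸ 3) * (suc m C 2))) n+h≡))
    (count-leafPaths-below-maximal n≡d+h)
    where
    d′ : ℕ
    d′ = n′ ∸ h
    n≡d+h : suc n′ ≡ suc d′ + h
    n≡d+h = cong suc (sym (m∸n+n≡m (halve-≤ ℓ≤2n∸2)))
    n+h≡ : (suc d′ + h) + h ≡ suc n′ + h * 2 / 2
    n+h≡ = sym (cong₂ _+_ n≡d+h (m*n/n≡m h 2))

  maximal : h * 2 ≡ 2 * suc n′ → Count (h * 2) (2 * (suc m ^ (h * 2 ∸ 2) * (suc (suc m) C 2)))
  maximal ℓ≡2n with refl ← *-cancelˡ-≡ h (suc n′) 2 (trans (*-comm 2 h) ℓ≡2n) =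
    subst₂ Count (sym ℓ≡h+h) (maximal-count≡ m n′) (count-leafPaths-maximal refl)
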